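{- Let $[x]t$ be a normal linear lambda term with exactly one free variable $x$. Then exactly one of the following holds: $t=x$ (the identity term); $[x]t$ is function-open, i.e. $x(u)$ is a subterm of $t$ for some $u$; $[x]t$ is value-open, i.e. $u(x)$ is a subterm of $t$ for some $u$.
   Context: Lambda skeletons: graded sets $\Lambda(i)$, least such that $\_\in\Lambda(1)$; $p\in\Lambda(j),q\in\Lambda(k)\Rightarrow p(q)\in\Lambda(j+k)$; $p\in\Lambda(i+1)\Rightarrow\lambda\_.p\in\Lambda(i)$. Linear lambda terms $[\Gamma]t$ decorating skeletons: $[x]x$ decorates $\_$; if $[\Gamma]t$ decorates $p$ and $[\Delta]u$ decorates $q$ then $[\Gamma,\Delta]t(u)$ decorates $p(q)$; if $[x,\Gamma]t$ decorates $p$ then $[\Gamma]\lambda x.t$ decorates $\lambda\_.p$; if $[\Gamma,y,x,\Delta]t$ decorates $p$ then $[\Gamma,x,y,\Delta]t$ decorates $p$. A term is normal if its skeleton admits a derivation in $\Lambda_R$ from the rules $v$: $\_\in\Lambda_B(1)$; $a$: $p\in\Lambda_B(j),q\in\Lambda_R(k)\Rightarrow p(q)\in\Lambda_B(j+k)$; $s$: $p\in\Lambda_B(i)\Rightarrow p\in\Lambda_R(i)$; $\ell$: $p\in\Lambda_R(i+1)\Rightarrow\lambda\_.p\in\Lambda_R(i)$. -}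

module Defs where

open import Data.Nat using (ℕ; suc; _+_)
open import Data.List using (List; []; _∷_; _++_)
open import Data.List.Relation.Binary.Disjoint.Propositional using (Disjoint)
open import Data.Product using (_×_; ∃)
open import Data.Sum using (_⊎_)
open import Relation.Nullary using (¬_)
open import Relation.Binary.PropositionalEquality using (_≡_; _≢_)

data Skel : Set where
  hole : Skel
  app  : Skel → Skel → Skel
  lam  : Skel → Skel

data Λ : ℕ → Skel → Set where
  Λ-hole : Λ 1 hole
  Λ-app  : ∀ {j k p q} → Λ j p → Λ k q → Λ (j + k) (app p q)
  Λ-lam  : ∀ {i p} → Λ (suc i) p → Λ i (lam p)

mutual
  data ΛB : ℕ → Skel → Set where
    v : ΛB 1 hole
    a : ∀ {j k p q} → ΛB j p → ΛR k q → ΛB (j + k) (app p q)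

  data ΛR : ℕ → Skel → Set where
    s : ∀ {i p} → ΛB i p → ΛR i p
    ℓ : ∀ {i p} → ΛR (suc i) p → ΛR i (lam p)

Var : Set
Var = ℕ

data Term : Set where
  var  : Var → Term
  _·_  : Term → Term → Term
  ƛ_⇒_ : Var → Term → Term

data Decorates : List Var → Term → Skel → Set where
  d-var : ∀ x → Decorates (x ∷ []) (var x) hole
  d-app : ∀ {Γ Δ t u p q} → Disjoint Γ Δ →
          Decorates Γ t p → Decorates Δ u q → Decorates (Γ ++ Δ) (t · u) (app p q)
  d-lam : ∀ {x Γ t p} → Decorates (x ∷ Γ) t p → Decorates Γ (ƛ x ⇒ t) (lam p)
  d-exc : ∀ {Γ Δ x y t p} → Decorates (Γ ++ y ∷ x ∷ Δ) t p →
          Decorates (Γ ++ x ∷ y ∷ Δ) t p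

Normal : List Var → Term → Set
Normal Γ t = ∃ λ p → Decorates Γ t p × ΛR (Data.List.length Γ) p
  where import Data.List

data _⊑_ : Term → Term → Set where
  ⊑-refl : ∀ {t} → t ⊑ t
  ⊑-appl : ∀ {s t u} → s ⊑ t → s ⊑ (t · u)
  ⊑-appr : ∀ {s t u} → s ⊑ u → s ⊑ (t · u)
  ⊑-lam  : ∀ {s y t} → s ⊑ t → s ⊑ (ƛ y ⇒ t)

-- x is never used as a bound variable in t (Barendregt convention / α-renaming)
data NotBound (x : Var) : Term → Set where
  nb-var : ∀ {y} → NotBound x (var y)
  nb-app : ∀ {t u} → NotBound x t → NotBound x u → NotBound x (t · u)
  nb-lam : ∀ {y t} → x ≢ y → NotBound x t → NotBound x (ƛ y ⇒ t)

FunctionOpen : Var → Term → Set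
FunctionOpen x t = ∃ λ u → (var x · u) ⊑ t

ValueOpen : Var → Term → Set
ValueOpen x t = ∃ λ u → (u · var x) ⊑ t

ExactlyOne : Set → Set → Set → Set
ExactlyOne A B C =
  (A ⊎ B ⊎ C) × ¬ (A × B) × ¬ (A × C) × ¬ (B × C)

module Submission where

-- At least one alternative holds.  By a mutual induction on the decoration
-- and on the Λ_B / Λ_R derivation of its skeleton, every variable x of the
-- context of a normal term is either the whole term, or the head of an
-- application x(u), or the argument of an application w(x): in a spine
-- p(q) with p ∈ Λ_B, a variable of p is the whole of p (so p(q) = x(q)) or
-- already exposed inside p, and a variable of q is the whole of q (so
-- p(q) = w(x)) or exposed inside q; under a binder the body cannot be the
-- variable x itself, because a variable decorates only a one-element context.
--
-- At most one alternative holds.  The identity term has no application as a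
-- subterm.  Linearity makes the number of occurrences of x in t equal to the
-- multiplicity of x in the context, here 1; but a term that is both
-- function-open and value-open contains at least two occurrences of x.

open import Defs
open import Data.List using (List; []; _∷_; _++_; map)
open import Data.List.Properties using (map-++)
open import Data.List.Membership.Propositional using (_∈_)
open import Data.List.Membership.Propositional.Properties using (∈-++⁻)
open import Data.List.Relation.Unary.Any using (here; there)
open import Data.List.Relation.Binary.Permutation.Propositional using (_↭_; ↭-refl; ↭-swap)
open import Data.List.Relation.Binary.Permutation.Propositional.Properties
  using (++⁺ˡ; map⁺; ∈-resp-↭)
open import Data.Nat using (ℕ; _+_; _≤_; _≟_)
open import Data.Nat.Properties using (+-identityʳ; 1+n≰n; ≤-refl; ≤-trans; ≤-reflexive; m≤m+n; m≤n+m; +-mono-≤)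
open import Data.Nat.ListAction using (sum)
open import Data.Nat.ListAction.Properties using (sum-++; sum-↭)
open import Data.Product using (_,_)
open import Data.Sum using (_⊎_; inj₁; inj₂)
open import Data.Empty using (⊥-elim)
open import Relation.Nullary using (¬_; yes; no)
open import Relation.Binary.PropositionalEquality
  using (_≡_; _≢_; refl; sym; trans; cong; cong₂; subst)

exchange-↭ : ∀ {A : Set} (Γ : List A) x y Δ → Γ ++ x ∷ y ∷ Δ ↭ Γ ++ y ∷ x ∷ Δ
exchange-↭ Γ x y Δ = ++⁺ˡ Γ (↭-swap x y ↭-refl)

exchanged-not-singleton : ∀ {A : Set} (Γ : List A) {x y z Δ} → Γ ++ y ∷ x ∷ Δ ≢ z ∷ []
exchanged-not-singleton []          ()
exchanged-not-singleton (_ ∷ [])    ()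
exchanged-not-singleton (_ ∷ _ ∷ _) ()

var-context : ∀ {Γ z p} → Decorates Γ (var z) p → Γ ≡ z ∷ []
var-context (d-var _)     = refl
var-context (d-exc {Γ} d) = ⊥-elim (exchanged-not-singleton Γ (var-context d))

⊑-trans : ∀ {r s t} → r ⊑ s → s ⊑ t → r ⊑ t
⊑-trans r⊑s ⊑-refl      = r⊑s
⊑-trans r⊑s (⊑-appl p)  = ⊑-appl (⊑-trans r⊑s p)
⊑-trans r⊑s (⊑-appr p)  = ⊑-appr (⊑-trans r⊑s p)
⊑-trans r⊑s (⊑-lam p)   = ⊑-lam (⊑-trans r⊑s p)

Open : Var → Term → Set
Open x t = FunctionOpen x t ⊎ ValueOpen x t

open-⊑ : ∀ {x s t} → s ⊑ t → Open x s → Open x t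
open-⊑ s⊑t (inj₁ (u , p)) = inj₁ (u , ⊑-trans p s⊑t)
open-⊑ s⊑t (inj₂ (u , p)) = inj₂ (u , ⊑-trans p s⊑t)

IdentityOrOpen : Var → Term → Set
IdentityOrOpen x t = t ≡ var x ⊎ Open x t

open-or : ∀ {x s t} → s ⊑ t → (s ≡ var x → Open x t) → IdentityOrOpen x s → IdentityOrOpen x t
open-or _   whole (inj₁ s≡x) = inj₂ (whole s≡x)
open-or s⊑t whole (inj₂ o)   = inj₂ (open-⊑ s⊑t o)

-- Every variable of the context of a term with skeleton in Λ_B (a spine
-- x₀(u₁)…(uₙ) with normal arguments) or in Λ_R (a normal term) is the whole
-- term or is exposed in it.
mutual
  spine-exposes : ∀ {x Γ t p n} → Decorates Γ t p → x ∈ Γ → ΛB n p → IdentityOrOpen x t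
  spine-exposes (d-var _) (here refl) v = inj₁ refl
  spine-exposes (d-app {Γ} {t = t} {u} _ dt du) x∈ (a bt ru) with ∈-++⁻ Γ x∈
  ... | inj₁ x∈Γ = open-or (⊑-appl ⊑-refl) (λ { refl → inj₁ (u , ⊑-refl) }) (spine-exposes dt x∈Γ bt)
  ... | inj₂ x∈Δ = open-or (⊑-appr ⊑-refl) (λ { refl → inj₂ (t , ⊑-refl) }) (normal-exposes du x∈Δ ru)
  spine-exposes (d-exc {Γ} {Δ} {y} {z} d) x∈ b =
    spine-exposes d (∈-resp-↭ (exchange-↭ Γ y z Δ) x∈) b

  normal-exposes : ∀ {x Γ t p n} → Decorates Γ t p → x ∈ Γ → ΛR n p → IdentityOrOpen x t
  normal-exposes d x∈ (s b) = spine-exposes d x∈ b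
  normal-exposes (d-lam d) x∈ (ℓ r) =
    open-or (⊑-lam ⊑-refl) (λ { refl → ⊥-elim (body-not-var (var-context d) x∈) })
      (normal-exposes d (there x∈) r)
    where
    body-not-var : ∀ {x y z : Var} {Γ} → y ∷ Γ ≡ z ∷ [] → ¬ (x ∈ Γ)
    body-not-var refl ()
  normal-exposes (d-exc {Γ} {Δ} {y} {z} d) x∈ r =
    normal-exposes d (∈-resp-↭ (exchange-↭ Γ y z Δ) x∈) r

[_≟_] : Var → Var → ℕ
[ x ≟ y ] with x ≟ y
... | yes _ = 1
... | no _  = 0

[≟]-refl : ∀ x → [ x ≟ x ] ≡ 1
[≟]-refl x with x ≟ x
... | yes _  = refl
... | no x≢x = ⊥-elim (x≢x refl)

[≟]-≢ : ∀ {x y} → x ≢ y → [ x ≟ y ] ≡ 0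
[≟]-≢ {x} {y} x≢y with x ≟ y
... | yes x≡y = ⊥-elim (x≢y x≡y)
... | no _    = refl

mult : Var → List Var → ℕ
mult x Γ = sum (map [ x ≟_] Γ)

mult-++ : ∀ x Γ Δ → mult x (Γ ++ Δ) ≡ mult x Γ + mult x Δ
mult-++ x Γ Δ = trans (cong sum (map-++ [ x ≟_] Γ Δ)) (sum-++ (map [ x ≟_] Γ) (map [ x ≟_] Δ))

mult-↭ : ∀ x {Γ Δ} → Γ ↭ Δ → mult x Γ ≡ mult x Δ
mult-↭ x Γ↭Δ = sum-↭ (map⁺ [ x ≟_] Γ↭Δ)

occ : Var → Term → ℕ
occ x (var y)   = [ x ≟ y ]
occ x (t · u)   = occ x t + occ x u
occ x (ƛ _ ⇒ t) = occ x t

occ-linear : ∀ {x Γ t p} → Decorates Γ t p → NotBound x t → occ x t ≡ mult x Γ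
occ-linear (d-var _) nb-var = sym (+-identityʳ _)
occ-linear {x} (d-app {Γ} {Δ} _ dt du) (nb-app nt nu) =
  trans (cong₂ _+_ (occ-linear dt nt) (occ-linear du nu)) (sym (mult-++ x Γ Δ))
occ-linear {x} (d-lam {y} dt) (nb-lam x≢y nt) =
  trans (occ-linear dt nt) (cong (_+ _) ([≟]-≢ x≢y))
occ-linear {x} (d-exc {Γ} {Δ} {y} {z} d) nb =
  trans (occ-linear d nb) (mult-↭ x (exchange-↭ Γ z y Δ))

occ-⊑ : ∀ {x s t} → s ⊑ t → occ x s ≤ occ x t
occ-⊑ ⊑-refl = ≤-refl
occ-⊑ {x} (⊑-appl {t = t} {u} p) = ≤-trans (occ-⊑ p) (m≤m+n (occ x t) (occ x u))
occ-⊑ {x} (⊑-appr {t = t} {u} p) = ≤-trans (occ-⊑ p) (m≤n+m (occ x u) (occ x t))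
occ-⊑ (⊑-lam p) = occ-⊑ p

function-open-occurs : ∀ {x u t} → (var x · u) ⊑ t → 1 ≤ occ x t
function-open-occurs {x} {u} p =
  ≤-trans (≤-trans (≤-reflexive (sym ([≟]-refl x))) (m≤m+n _ (occ x u))) (occ-⊑ p)

value-open-occurs : ∀ {x w t} → (w · var x) ⊑ t → 1 ≤ occ x t
value-open-occurs {x} {w} p =
  ≤-trans (≤-trans (≤-reflexive (sym ([≟]-refl x))) (m≤n+m _ (occ x w))) (occ-⊑ p)

-- A term both function-open and value-open in x has two occurrences of x:
-- the head of x(u) and the argument of w(x) are different positions.
both-open-occurs-twice : ∀ {x u w t} → (var x · u) ⊑ t → (w · var x) ⊑ t → 2 ≤ occ x t
both-open-occurs-twice {x} ⊑-refl ⊑-refl =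
  ≤-reflexive (sym (cong₂ _+_ ([≟]-refl x) ([≟]-refl x)))
both-open-occurs-twice ⊑-refl (⊑-appl ())
both-open-occurs-twice {x} ⊑-refl (⊑-appr g) =
  +-mono-≤ (≤-reflexive (sym ([≟]-refl x))) (value-open-occurs g)
both-open-occurs-twice {x} (⊑-appl f) ⊑-refl =
  +-mono-≤ (function-open-occurs f) (≤-reflexive (sym ([≟]-refl x)))
both-open-occurs-twice (⊑-appr ()) ⊑-refl
both-open-occurs-twice (⊑-appl f) (⊑-appr g) = +-mono-≤ (function-open-occurs f) (value-open-occurs g)
both-open-occurs-twice (⊑-appr f) (⊑-appl g) = +-mono-≤ (value-open-occurs g) (function-open-occurs f)
both-open-occurs-twice {x} (⊑-appl {u = u} f) (⊑-appl g) =
  ≤-trans (both-open-occurs-twice f g) (m≤m+n _ (occ x u))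
both-open-occurs-twice {x} (⊑-appr {t = t} f) (⊑-appr g) =
  ≤-trans (both-open-occurs-twice f g) (m≤n+m _ (occ x t))
both-open-occurs-twice (⊑-lam f) (⊑-lam g) = both-open-occurs-twice f g

proposition4p3 : ∀ (x : Var) (t : Term) → Normal (x ∷ []) t → NotBound x t →
    ExactlyOne (t ≡ var x) (FunctionOpen x t) (ValueOpen x t)
proposition4p3 x t (p , d , r) nb =
    normal-exposes d (here refl) r
  , (λ { (refl , (_ , ())) })
  , (λ { (refl , (_ , ())) })
  , λ { ((_ , f) , (_ , g)) → not-twice (both-open-occurs-twice f g) }
  where
  occurs-once : occ x t ≡ 1
  occurs-once = trans (occ-linear d nb) (cong (_+ 0) ([≟]-refl x))

  not-twice : ¬ (2 ≤ occ x t)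
  not-twice two≤ = 1+n≰n (subst (2 ≤_) occurs-once two≤)
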